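{- Let $S$ be a castlable monoid with set of irreducible elements $\mathcal P$. If $k\ge1$ and $p,q_1,\dots,q_k\in\mathcal P$ satisfy $p^k=q_1q_2\cdots q_k$, then $q_1=q_2=\cdots=q_k=p$. In particular, $\tau(p^k)=k+1$.
   Context: Integral monoid: $G$ countable group, $G\ne\{1\}$, $S\subseteq G$ submonoid with (I) $S\cap S^{ -1}=\{1\}$; (II) every $u\in G$ is $u=xy^{ -1}$ ($x,y\in S$) with: whenever $u=zw^{ -1}$, $z,w\in S$, there is $c\in S$ with $z=xc,w=yc$; (III) each $u\in S$ has finitely many factorizations in $S$. $\mathrm{lcm}[u,v]$ is the $w$ with $uS\cap vS=wS$; $\gcd(u,v)$ the lcm of common divisors ($u\mid w$ iff $w\in uS$). $\tau(z)=\#\{(z_1,z_2)\in S^2:z=z_1z_2\}$, $\mathcal P=\{p:\tau(p)=2\}$. $\mathfrak C_1=\{(u,u^{ -1}\mathrm{lcm}[u,v]):\gcd(u,v)=1\}$, $\Gamma_1=\{((u,u^{ -1}\mathrm{lcm}[u,v]),(v,v^{ -1}\mathrm{lcm}[u,v])):\gcd(u,v)=1\}$. $\mathfrak C\subseteq S\times S$, $\Gamma\subseteq\mathfrak C\times\mathfrak C$ are the smallest sets with: $\Gamma_1\subseteq\Gamma$, $\mathfrak C_1\subseteq\mathfrak C$; $((p,p),(p,p))\in\Gamma$ for $p\in\mathcal P$; if $u_1,u_2\ne1$, $((u_2,v),(\tilde v,\tilde u_2))\in\Gamma$, $((u_1,\tilde v),(\tilde{\tilde v},\tilde u_1))\in\Gamma$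 then $((u_1u_2,v),(\tilde{\tilde v},\tilde u_1\tilde u_2))\in\Gamma$; if $v_1,v_2\ne1$, $((u,v_1),(\tilde v_1,\tilde u))\in\Gamma$, $((\tilde u,v_2),(\tilde v_2,\tilde{\tilde u}))\in\Gamma$ then $((u,v_1v_2),(\tilde v_1\tilde v_2,\tilde{\tilde u}))\in\Gamma$ (all pairs occurring lie in $\mathfrak C$). $S$ is castlable if it is integral and (Axiom IV) $\Gamma$ is the graph of a map $\eta:\mathfrak C\to\mathfrak C$. -}

module Defs where

open import Data.Nat using (ℕ; zero; suc)
open import Data.Product using (Σ; ∃; _×_; _,_)
open import Data.Sum using (_⊎_)
open import Data.List using (List; length)
open import Data.List.Membership.Propositional using (_∈_)
open import Data.List.Relation.Unary.Unique.Propositional using (Unique)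
open import Data.Vec using (Vec; foldr)
open import Function.Definitions using (Injective)
open import Relation.Nullary using (¬_)
open import Relation.Binary.PropositionalEquality using (_≡_)
open import Algebra.Structures using (IsGroup)

record IntegralMonoid : Set₁ where
  infixl 7 _∙_
  field
    G       : Set
    _∙_     : G → G → G
    ε       : G
    _⁻¹     : G → G
    isGroup : IsGroup _≡_ _∙_ ε _⁻¹
    countable  : Σ (G → ℕ) (λ f → Injective _≡_ _≡_ f)
    nontrivial : Σ G (λ g → ¬ (g ≡ ε))
    S       : G → Set
    S-ε     : S ε
    S-∙     : ∀ {x y} → S x → S y → S (x ∙ y)
    axI     : ∀ {x} → S x → S (x ⁻¹) → x ≡ ε
    axII    : ∀ u → Σ G λ x → Σ G λ y → S x × S y × u ≡ x ∙ (y ⁻¹) ×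
                (∀ z w → S z → S w → u ≡ z ∙ (w ⁻¹) →
                   Σ G λ c → S c × z ≡ x ∙ c × w ≡ y ∙ c)
    -- Axiom (III): each u ∈ S has finitely many factorizations in S
    axIII   : ∀ u → S u → Σ (List (G × G)) λ L →
                ∀ a b → S a → S b → u ≡ a ∙ b → (a , b) ∈ L

module _ (M : IntegralMonoid) where
  open IntegralMonoid M

  _∣_ : G → G → Set
  u ∣ w = Σ G λ s → S s × w ≡ u ∙ s

  -- w = lcm[u,v]  iff  uS ∩ vS = wS
  IsLcm : G → G → G → Set
  IsLcm u v w = ∀ x → ((u ∣ x × v ∣ x) → w ∣ x) × (w ∣ x → (u ∣ x × v ∣ x))

  -- g = gcd(u,v): g is the lcm of the set of common divisors of u and v,
  -- i.e. ⋂_{d ∈ S, d∣u, d∣v} dS = gS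
  IsGcd : G → G → G → Set
  IsGcd u v g = ∀ x → ((∀ d → S d → d ∣ u → d ∣ v → d ∣ x) → g ∣ x)
                    × (g ∣ x → (∀ d → S d → d ∣ u → d ∣ v → d ∣ x))

  HasTau : G → ℕ → Set
  HasTau z n = Σ (List (G × G)) λ L → Unique L × length L ≡ n ×
                 (∀ a b → ((a , b) ∈ L) → S a × S b × z ≡ a ∙ b) ×
                 (∀ a b → S a → S b → z ≡ a ∙ b → (a , b) ∈ L)

  Irreducible : G → Set
  Irreducible p = S p × HasTau p 2

  data Γ : G × G → G × G → Set where
    γ₁ : ∀ {u v w} → S u → S v → IsGcd u v ε → IsLcm u v w →
         Γ (u , (u ⁻¹) ∙ w) (v , (v ⁻¹) ∙ w)
    γ𝒫 : ∀ {p} → Irreducible p → Γ (p , p) (p , p)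
    γu : ∀ {u₁ u₂ v ṽ ṽ̃ ũ₁ ũ₂} → ¬ (u₁ ≡ ε) → ¬ (u₂ ≡ ε) →
         Γ (u₂ , v) (ṽ , ũ₂) → Γ (u₁ , ṽ) (ṽ̃ , ũ₁) →
         Γ (u₁ ∙ u₂ , v) (ṽ̃ , ũ₁ ∙ ũ₂)
    γv : ∀ {u v₁ v₂ ṽ₁ ṽ₂ ũ ũ̃} → ¬ (v₁ ≡ ε) → ¬ (v₂ ≡ ε) →
         Γ (u , v₁) (ṽ₁ , ũ) → Γ (ũ , v₂) (ṽ₂ , ũ̃) →
         Γ (u , v₁ ∙ v₂) (ṽ₁ ∙ ṽ₂ , ũ̃)

  -- 𝔠: the pairs occurring in Γ (this contains 𝔠₁, via γ₁)
  𝔠 : G × G → Set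
  𝔠 x = Σ (G × G) λ y → Γ x y ⊎ Γ y x

  -- Axiom (IV): Γ is the graph of a map η : 𝔠 → 𝔠
  Castlable : Set
  Castlable = (∀ x → 𝔠 x → Σ (G × G) λ y → Γ x y)
            × (∀ x y y′ → Γ x y → Γ x y′ → y ≡ y′)

  pow : G → ℕ → G
  pow p zero    = ε
  pow p (suc k) = p ∙ pow p k

  prod : ∀ {k} → Vec G k → G
  prod = foldr _ _∙_ ε

{-# OPTIONS --safe #-}
-- Every factorisation p^(k+1) = a b is p^i p^j.  Either p ∣ a, and induction applies to
-- p^k = (p⁻¹a) b; or p and a are coprime.  Then write p⁻¹a = x y⁻¹ in lowest terms, so
-- lcm[p,a] = p x = a y, and x divides p^k, hence x = p^i by induction.  If i = 0 then
-- a divides the irreducible p, so a = 1.  If i > 0 then ((p, p^i), (a, y)) ∈ Γ by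
-- coprimality and ((p, p^i), (p^i, p)) ∈ Γ from p^i = p⋯p, so a = p^i since Γ is the
-- graph of a map, contradicting p ∤ a.  Both claims follow: a product of k irreducibles
-- equal to p^k peels off one factor p at a time, and the k + 1 factorisations of p^k are
-- exactly the pairs (p^i, p^(k-i)).
module Submission where

open import Defs hiding (_∣_)

open import Algebra.Bundles using (Group)
import Algebra.Properties.Group as GroupProperties
open import Data.Empty using (⊥-elim)
open import Data.List using (List; []; _∷_; length; applyUpTo)
open import Data.List.Membership.Propositional using (_∈_)
open import Data.List.Membership.Propositional.Properties using (∈-applyUpTo⁺; ∈-applyUpTo⁻)
open import Data.List.Properties using (length-applyUpTo)
open import Data.List.Relation.Unary.All using ([]; _∷_)
open import Data.List.Relation.Unary.Any using (here; there)
open import Data.List.Relation.Unary.AllPairs using (_∷_)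
open import Data.List.Relation.Unary.Unique.Propositional using (Unique)
open import Data.List.Relation.Unary.Unique.Propositional.Properties using (applyUpTo⁺₁)
open import Data.Nat using (ℕ; zero; suc; _+_; _∸_; _≥_; s≤s)
open import Data.Nat.Properties using (eq?; <⇒≢; m≤m+n; m+n∸m≡n; m+[n∸m]≡n)
open import Data.Product using (Σ; ∃₂; _×_; _,_; proj₁; proj₂)
open import Data.Sum using (_⊎_; inj₁; inj₂; [_,_]′; swap) renaming (map to ⊎-map)
open import Data.Vec using (Vec; []; _∷_)
open import Data.Vec.Relation.Unary.All using (All; []; _∷_) renaming (map to All-map)
open import Function.Base using (id)
open import Function.Bundles using (mk↣)
open import Relation.Binary.Definitions using (DecidableEquality)
open import Relation.Nullary using (¬_; Dec; yes; no)
open import Relation.Binary.PropositionalEquality using (_≡_; _≢_; refl; sym; trans; cong; subst)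

module GroupFractions {c ℓ} (𝔾 : Group c ℓ) where
  open Group 𝔾
  open GroupProperties 𝔾 using (\\-leftDividesˡ; \\-leftDividesʳ; //-rightDividesˡ; x≈z//y)
  open import Relation.Binary.Reasoning.Setoid setoid

  \\≈//⇒∙≈∙ : ∀ {u v x y} → u \\ v ≈ x // y → v ∙ y ≈ u ∙ x
  \\≈//⇒∙≈∙ {u} {v} {x} {y} e = begin
    v ∙ y               ≈⟨ \\-leftDividesˡ u (v ∙ y) ⟨
    u ∙ (u \\ (v ∙ y))  ≈⟨ ∙-congˡ (assoc (u ⁻¹) v y) ⟨
    u ∙ ((u \\ v) ∙ y)  ≈⟨ ∙-congˡ (∙-congʳ e) ⟩
    u ∙ ((x // y) ∙ y)  ≈⟨ ∙-congˡ (//-rightDividesˡ y x) ⟩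
    u ∙ x               ∎

  ∙≈∙⇒\\≈// : ∀ {u v x y} → v ∙ y ≈ u ∙ x → u \\ v ≈ x // y
  ∙≈∙⇒\\≈// {u} {v} {x} {y} e = x≈z//y (u \\ v) y x (begin
    (u \\ v) ∙ y  ≈⟨ assoc (u ⁻¹) v y ⟩
    u \\ (v ∙ y)  ≈⟨ ∙-congˡ e ⟩
    u \\ (u ∙ x)  ≈⟨ \\-leftDividesʳ u x ⟩
    x             ∎)

∈-pair⁻ : ∀ {A : Set} {a b z : A} → z ∈ a ∷ b ∷ [] → z ≡ a ⊎ z ≡ b
∈-pair⁻ (here refl)         = inj₁ refl
∈-pair⁻ (there (here refl)) = inj₂ refl

∈-length-2 : ∀ {A : Set} {xs : List A} {x y z : A} → length xs ≡ 2 →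
             x ∈ xs → y ∈ xs → x ≢ y → z ∈ xs → z ≡ x ⊎ z ≡ y
∈-length-2 {xs = _ ∷ _ ∷ []} refl x∈ y∈ x≢y z∈
  with ∈-pair⁻ x∈ | ∈-pair⁻ y∈
... | inj₁ refl | inj₁ refl = ⊥-elim (x≢y refl)
... | inj₂ refl | inj₂ refl = ⊥-elim (x≢y refl)
... | inj₁ refl | inj₂ refl = ∈-pair⁻ z∈
... | inj₂ refl | inj₁ refl = swap (∈-pair⁻ z∈)

module IntegralMonoidProperties (M : IntegralMonoid) where
  open IntegralMonoid M

  group : Group _ _
  group = record { isGroup = isGroup }

  open Group group using (_\\_; _//_; identityˡ; identityʳ; assoc)
  open GroupProperties group using (∙-cancelˡ; inverseʳ-unique; \\-leftDividesʳ)
  open GroupFractions group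

  _∣_ : G → G → Set
  _∣_ = Defs._∣_ M

  _^_ : G → ℕ → G
  _^_ = pow M

  _≟_ : DecidableEquality G
  _≟_ = eq? (mk↣ (proj₂ countable))

  S-∙≡ε : ∀ {x y} → S x → S y → x ∙ y ≡ ε → x ≡ ε × y ≡ ε
  S-∙≡ε {x} {y} Sx Sy xy≡ε = x≡ε , y≡ε
    where
    x≡ε : x ≡ ε
    x≡ε = axI Sx (subst S (inverseʳ-unique x y xy≡ε) Sy)
    y≡ε : y ≡ ε
    y≡ε = trans (sym (identityˡ y)) (trans (cong (_∙ y) (sym x≡ε)) xy≡ε)

  ε∣ : ∀ {u} → S u → ε ∣ u
  ε∣ {u} Su = u , Su , sym (identityˡ u)

  -- Axiom (II) reads  ∀ u → ∃₂ (IsReducedFraction u).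
  IsReducedFraction : G → G → G → Set
  IsReducedFraction u x y = S x × S y × u ≡ x // y ×
    (∀ z w → S z → S w → u ≡ z // w → Σ G λ c → S c × z ≡ x ∙ c × w ≡ y ∙ c)

  module _ {u v x y : G} (red : IsReducedFraction (u \\ v) x y) where

    reduced-∙≡ : v ∙ y ≡ u ∙ x
    reduced-∙≡ = \\≈//⇒∙≈∙ (proj₁ (proj₂ (proj₂ red)))

    reduced-factor : ∀ {s t} → S s → S t → u ∙ s ≡ v ∙ t →
                     Σ G λ c → S c × s ≡ x ∙ c × t ≡ y ∙ c
    reduced-factor Ss St us≡vt =
      proj₂ (proj₂ (proj₂ red)) _ _ Ss St (∙≈∙⇒\\≈// (sym us≡vt))

    reduced-lcm : IsLcm M u v (u ∙ x)
    reduced-lcm m = common⇒lcm∣ , lcm∣⇒common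
      where
      Sx : S x
      Sx = proj₁ red
      Sy : S y
      Sy = proj₁ (proj₂ red)
      common⇒lcm∣ : u ∣ m × v ∣ m → (u ∙ x) ∣ m
      common⇒lcm∣ ((s , Ss , m≡us) , (t , St , m≡vt)) with reduced-factor Ss St (trans (sym m≡us) m≡vt)
      ... | c , Sc , s≡xc , _ = c , Sc , trans m≡us (trans (cong (u ∙_) s≡xc) (sym (assoc u x c)))
      lcm∣⇒common : (u ∙ x) ∣ m → u ∣ m × v ∣ m
      lcm∣⇒common (c , Sc , m≡uxc) =
        (x ∙ c , S-∙ Sx Sc , trans m≡uxc (assoc u x c)) ,
        (y ∙ c , S-∙ Sy Sc , trans m≡uxc (trans (cong (_∙ c) (sym reduced-∙≡)) (assoc v y c)))

    ∣⇒reduced-denominator≡ε : u ∣ v → y ≡ ε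
    ∣⇒reduced-denominator≡ε (s , Ss , v≡us) with reduced-factor Ss S-ε (trans (sym v≡us) (sym (identityʳ v)))
    ... | c , Sc , _ , ε≡yc = proj₁ (S-∙≡ε (proj₁ (proj₂ red)) Sc (sym ε≡yc))

  _∣?_ : ∀ u v → Dec (u ∣ v)
  u ∣? v with axII (u \\ v)
  ... | x , y , red with y ≟ ε
  ...   | yes refl = yes (x , proj₁ red , trans (sym (identityʳ v)) (reduced-∙≡ red))
  ...   | no y≢ε   = no (λ u∣v → y≢ε (∣⇒reduced-denominator≡ε red u∣v))

  common-divisors≡ε⇒IsGcd-ε : ∀ {u v} → S u → S v → (∀ d → S d → d ∣ u → d ∣ v → d ≡ ε) → IsGcd M u v ε
  common-divisors≡ε⇒IsGcd-ε Su Sv trivial m =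
    (λ common → common ε S-ε (ε∣ Su) (ε∣ Sv)) ,
    (λ ε∣m d Sd d∣u d∣v → subst (_∣ m) (sym (trivial d Sd d∣u d∣v)) ε∣m)

  Γ-coprime : ∀ {u v x y} → S u → S v → IsGcd M u v ε → IsReducedFraction (u \\ v) x y →
              Γ M (u , x) (v , y)
  Γ-coprime {u} {v} {x} {y} Su Sv gcd red =
    subst (λ w → Γ M (u , x) (v , w)) v\\ux≡y
      (subst (λ w → Γ M (u , w) (v , v \\ (u ∙ x))) (\\-leftDividesʳ u x)
        (γ₁ Su Sv gcd (reduced-lcm red)))
    where
    v\\ux≡y : v \\ (u ∙ x) ≡ y
    v\\ux≡y = trans (cong (v \\_) (sym (reduced-∙≡ red))) (\\-leftDividesʳ v y)

  irreducible⇒≢ε : ∀ {q} → Irreducible M q → q ≢ ε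
  irreducible⇒≢ε (_ , [] , _ , () , _) _
  irreducible⇒≢ε (_ , _ ∷ [] , _ , () , _) _
  irreducible⇒≢ε (_ , _ ∷ _ ∷ _ ∷ _ , _ , () , _) _
  irreducible⇒≢ε (_ , a ∷ b ∷ [] , ((a≢b ∷ []) ∷ _) , _ , sound , _) refl =
    a≢b (trans (factor≡εε a (here refl)) (sym (factor≡εε b (there (here refl)))))
    where
    factor≡εε : ∀ f → f ∈ a ∷ b ∷ [] → f ≡ (ε , ε)
    factor≡εε (f₁ , f₂) f∈ with sound f₁ f₂ f∈
    ... | Sf₁ , Sf₂ , ε≡f₁f₂ with S-∙≡ε Sf₁ Sf₂ (sym ε≡f₁f₂)
    ...   | refl , refl = refl

  irreducible-divisor : ∀ {q d} → Irreducible M q → S d → d ∣ q → d ≡ ε ⊎ d ≡ q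
  irreducible-divisor {q} {d} irr@(Sq , _ , _ , length≡2 , _ , complete) Sd (s , Ss , q≡ds) =
    ⊎-map (cong proj₁) (cong proj₁)
      (∈-length-2 length≡2
        (complete ε q S-ε Sq (sym (identityˡ q)))
        (complete q ε Sq S-ε (sym (identityʳ q)))
        (λ e → irreducible⇒≢ε irr (sym (cong proj₁ e)))
        (complete d s Sd Ss q≡ds))

  irreducible-coprime : ∀ {p a} → Irreducible M p → S a → ¬ p ∣ a → IsGcd M p a ε
  irreducible-coprime irr Sa p∤a = common-divisors≡ε⇒IsGcd-ε (proj₁ irr) Sa λ d Sd d∣p d∣a →
    [ id , (λ { refl → ⊥-elim (p∤a d∣a) }) ]′ (irreducible-divisor irr Sd d∣p)

  S-prod : ∀ {k} (qs : Vec G k) → All S qs → S (prod M qs)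
  S-prod []       []         = S-ε
  S-prod (_ ∷ qs) (Sq ∷ Sqs) = S-∙ Sq (S-prod qs Sqs)

  module Powers {p : G} (Sp : S p) where

    S-^ : ∀ k → S (p ^ k)
    S-^ zero    = S-ε
    S-^ (suc k) = S-∙ Sp (S-^ k)

    ^-+ : ∀ i j → p ^ (i + j) ≡ p ^ i ∙ p ^ j
    ^-+ zero    j = sym (identityˡ (p ^ j))
    ^-+ (suc i) j = trans (cong (p ∙_) (^-+ i j)) (sym (assoc p (p ^ i) (p ^ j)))

    ^-suc≢ε : p ≢ ε → ∀ m → p ^ suc m ≢ ε
    ^-suc≢ε p≢ε m e = p≢ε (proj₁ (S-∙≡ε Sp (S-^ m) e))

    ^-injective : p ≢ ε → ∀ {m n} → p ^ m ≡ p ^ n → m ≡ n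
    ^-injective p≢ε {zero}  {zero}  _ = refl
    ^-injective p≢ε {zero}  {suc n} e = ⊥-elim (^-suc≢ε p≢ε n (sym e))
    ^-injective p≢ε {suc m} {zero}  e = ⊥-elim (^-suc≢ε p≢ε m e)
    ^-injective p≢ε {suc m} {suc n} e = cong suc (^-injective p≢ε (∙-cancelˡ p (p ^ m) (p ^ n) e))

  Γ-^ : ∀ {p} → Irreducible M p → ∀ m → Γ M (p , p ^ suc m) (p ^ suc m , p)
  Γ-^ {p} irr zero =
    subst (λ w → Γ M (p , w) (w , p)) (sym (identityʳ p)) (γ𝒫 irr)
  Γ-^ {p} irr (suc m) =
    γv (irreducible⇒≢ε irr) (^-suc≢ε (irreducible⇒≢ε irr) m) (γ𝒫 irr) (Γ-^ irr m)
    where open Powers (proj₁ irr)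

module CastlableProperties (M : IntegralMonoid) (castlable : Castlable M) where
  open IntegralMonoid M
  open IntegralMonoidProperties M
  open Group group using (_\\_; identityˡ; identityʳ; assoc)
  open GroupProperties group using (∙-cancelˡ)

  Γ-functional : ∀ {x y y′} → Γ M x y → Γ M x y′ → y ≡ y′
  Γ-functional = proj₂ castlable _ _ _

  module _ {p : G} (irr : Irreducible M p) where
    open Powers (proj₁ irr)

    Sp : S p
    Sp = proj₁ irr

    coprime-divisor-of-^ : ∀ {a y} i → S a → ¬ p ∣ a → IsReducedFraction (p \\ a) (p ^ i) y → a ≡ ε
    coprime-divisor-of-^ {y = y} zero Sa p∤a red
      with irreducible-divisor irr Sa (y , proj₁ (proj₂ red) , sym (trans (reduced-∙≡ red) (identityʳ p)))
    ... | inj₁ a≡ε = a≡ε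
    ... | inj₂ refl = ⊥-elim (p∤a (ε , S-ε , sym (identityʳ p)))
    coprime-divisor-of-^ (suc i) Sa p∤a red
      with Γ-functional (Γ-coprime Sp Sa (irreducible-coprime irr Sa p∤a) red) (Γ-^ irr i)
    ... | refl = ⊥-elim (p∤a (p ^ i , S-^ i , refl))

    ^-factorisation : ∀ k {a b} → S a → S b → p ^ k ≡ a ∙ b →
                      ∃₂ λ i j → i + j ≡ k × a ≡ p ^ i × b ≡ p ^ j
    ^-factorisation zero Sa Sb ε≡ab with S-∙≡ε Sa Sb (sym ε≡ab)
    ... | a≡ε , b≡ε = 0 , 0 , refl , a≡ε , b≡ε
    ^-factorisation (suc k) {a} {b} Sa Sb e with p ∣? a
    ... | yes (s , Ss , a≡ps) =
      let i , j , i+j≡k , s≡pⁱ , b≡pʲ = ^-factorisation k Ss Sb pᵏ≡sb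
      in suc i , j , cong suc i+j≡k , trans a≡ps (cong (p ∙_) s≡pⁱ) , b≡pʲ
      where
      pᵏ≡sb : p ^ k ≡ s ∙ b
      pᵏ≡sb = ∙-cancelˡ p _ _ (trans e (trans (cong (_∙ b) a≡ps) (assoc p s b)))
    ... | no p∤a with axII (p \\ a)
    ...   | x , y , red with reduced-factor red (S-^ k) Sb e
    ...     | c , Sc , pᵏ≡xc , _ with ^-factorisation k (proj₁ red) Sc pᵏ≡xc
    ...       | i , _ , _ , refl , _ =
      0 , suc k , refl , a≡ε , sym (trans e (trans (cong (_∙ b) a≡ε) (identityˡ b)))
      where
      a≡ε : a ≡ ε
      a≡ε = coprime-divisor-of-^ i Sa p∤a red

    ^≡prod⇒all≡ : ∀ k (qs : Vec G k) → All (Irreducible M) qs → p ^ k ≡ prod M qs → All (_≡ p) qs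
    ^≡prod⇒all≡ zero    []       []           _ = []
    ^≡prod⇒all≡ (suc k) (q ∷ qs) (irrq ∷ irrqs) e
      with ^-factorisation (suc k) (proj₁ irrq) (S-prod qs (All-map proj₁ irrqs)) e
    ... | zero  , _ , _ , q≡ε , _ = ⊥-elim (irreducible⇒≢ε irrq q≡ε)
    ... | suc i , _ , _ , q≡ppⁱ , _ with irreducible-divisor irrq Sp (p ^ i , S-^ i , q≡ppⁱ)
    ...   | inj₁ p≡ε  = ⊥-elim (irreducible⇒≢ε irr p≡ε)
    ...   | inj₂ refl = refl ∷ ^≡prod⇒all≡ k qs irrqs (∙-cancelˡ p _ _ e)

    τ[^] : ∀ k → HasTau M (p ^ k) (suc k)
    τ[^] k = applyUpTo factors (suc k) , unique , length-applyUpTo factors (suc k) , sound , complete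
      where
      factors : ℕ → G × G
      factors i = p ^ i , p ^ (k ∸ i)
      unique : Unique (applyUpTo factors (suc k))
      unique = applyUpTo⁺₁ factors (suc k) λ i<j _ e →
        <⇒≢ i<j (^-injective (irreducible⇒≢ε irr) (cong proj₁ e))
      sound : ∀ a b → (a , b) ∈ applyUpTo factors (suc k) → S a × S b × p ^ k ≡ a ∙ b
      sound a b ab∈ with ∈-applyUpTo⁻ factors ab∈
      ... | i , s≤s i≤k , refl = S-^ i , S-^ (k ∸ i) , trans (cong (p ^_) (sym (m+[n∸m]≡n i≤k))) (^-+ i (k ∸ i))
      complete : ∀ a b → S a → S b → p ^ k ≡ a ∙ b → (a , b) ∈ applyUpTo factors (suc k)
      complete a b Sa Sb e with ^-factorisation k Sa Sb e
      ... | i , j , refl , refl , refl =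
        subst (λ n → (p ^ i , p ^ n) ∈ applyUpTo factors (suc (i + j))) (m+n∸m≡n i j)
          (∈-applyUpTo⁺ factors (s≤s (m≤m+n i j)))

mainTheorem10 : (M : IntegralMonoid) → Castlable M →
    (p : IntegralMonoid.G M) → Irreducible M p → (k : ℕ) → k ≥ 1 →
    ((qs : Vec (IntegralMonoid.G M) k) → All (Irreducible M) qs →
       pow M p k ≡ prod M qs → All (λ q → q ≡ p) qs)
    × HasTau M (pow M p k) (suc k)
mainTheorem10 M castlable p irr k _ = ^≡prod⇒all≡ irr k , τ[^] irr k
  where open CastlableProperties M castlable
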